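{- Let $f$ be a graph parameter and let $z\in\mathcal{G}_2$ be a contractor for $f$. Then concatenation induces a well-defined associative bilinear operation $\circ$ on $\mathcal{G}_2/f$, and the image of $z$ under the quotient map $\mathcal{G}_2\to\mathcal{G}_2/f$ is the unit element of the algebra $(\mathcal{G}_2/f,+,\circ)$.
   Context: Graphs are finite and may have multiple edges. For an integer $k\ge 0$, a $k$-labeled graph is a graph in which $k$ distinct nodes carry the labels $1,\dots,k$ (one node per label); other nodes are unlabeled. The product $F_1F_2$ of two $k$-labeled graphs is obtained by taking their disjoint union and identifying nodes with the same label. $\mathcal{G}_k$ is the real vector space of formal finite linear combinations of $k$-labeled graphs ($k$-labeled quantum graphs), made into a commutative algebra by extending the product bilinearly. $\mathcal{G}_k^0\subseteq\mathcal{G}_k$ is the subalgebra spanned by $k$-labeled graphs whose labeled nodes are pairwise nonadjacent. A graph parameter is a real-valued isomorphism-invariant function $f$ on graphs; it is applied to labeled graphs by forgetting labels and extended linearly to quantum graphs. $\mathcal{N}_k(f)=\{x\in\mathcal{G}_k: f(xy)=0\ \forall y\in\mathcal{G}_k\}$, $x\equiv y\pmod f$ means $x-y\in\mathcal{N}_k(f)$, and $\mathcal{G}_k/f=\mathcal{G}_k/\mathcal{N}_k(f)$. For a 2-labeled graph $F$ with nonadjacent labeled nodes, $F'$ is the 1-labeled graph obtained by identifying the two labeled nodes (the new node gets label 1); this extends linearly to a map $x\mapsto x'$ from $\mathcal{G}_2^0$ to $\mathcal{G}_1$. An element $z\in\mathcal{G}_2$ is a contractor for $f$ if $f(xz)=f(x')$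 for every $x\in\mathcal{G}_2^0$. For two 2-labeled graphs $F_1,F_2$, their concatenation $F_1\circ F_2$ is the 2-labeled graph obtained by identifying node 2 of $F_1$ with node 1 of $F_2$ and unlabeling this new node (node 1 of $F_1$ keeps label 1, node 2 of $F_2$ becomes label 2); it is extended bilinearly to $\mathcal{G}_2$. -}

module Defs where

open import Level using (_⊔_)
open import Data.Nat using (ℕ; zero; suc; _+_)
open import Data.Nat.Properties using (+-comm)
open import Data.Fin using (Fin; zero; suc; _↑ˡ_; _↑ʳ_; splitAt)
open import Data.Sum using (_⊎_; inj₁; inj₂)
open import Data.Maybe using (Maybe; just; nothing)
open import Data.Product using (Σ; _×_; _,_; proj₁; proj₂)
open import Data.List using (List; []; _∷_; _++_; map; concatMap)
open import Function.Bundles using (_↔_; Inverse)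
open import Relation.Binary.PropositionalEquality using (_≡_; refl; cong₂)
open import Algebra.Bundles using (CommutativeRing)

record Graph : Set where
  field
    n        : ℕ
    adj      : Fin n → Fin n → ℕ
    sym      : ∀ i j → adj i j ≡ adj j i
    loopless : ∀ i → adj i i ≡ 0

_≅_ : Graph → Graph → Set
G ≅ H = Σ (Fin (Graph.n G) ↔ Fin (Graph.n H)) λ π →
          ∀ i j → Graph.adj H (Inverse.to π i) (Inverse.to π j) ≡ Graph.adj G i j

-- k-labeled graphs: nodes Fin (k + u); the node  i ↑ˡ u  carries label i
-- (i : Fin k, label i corresponds to the paper's label i+1); the u nodes
-- k ↑ʳ j are unlabeled.  (Every k-labeled graph is isomorphic, as a
-- labeled graph, to one of this form.)

record LGraph (k : ℕ) : Set where
  field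
    u        : ℕ
    adj      : Fin (k + u) → Fin (k + u) → ℕ
    sym      : ∀ i j → adj i j ≡ adj j i
    loopless : ∀ i → adj i i ≡ 0

forget : ∀ {k} → LGraph k → Graph
forget {k} F = record { n = k + LGraph.u F ; adj = LGraph.adj F
                      ; sym = LGraph.sym F ; loopless = LGraph.loopless F }

-- pull back an adjacency function along a partial map (used to place a
-- graph inside a glued node set; the partial maps used are injective on
-- their domains)
pull : ∀ {m} {X : Set} → (Fin m → Fin m → ℕ) → (X → Maybe (Fin m)) → X → X → ℕ
pull a p x y with p x | p y
... | just i | just j = a i j
... | _      | _      = 0

pull-sym : ∀ {m} {X : Set} (a : Fin m → Fin m → ℕ) → (∀ i j → a i j ≡ a j i) →
           (p : X → Maybe (Fin m)) → ∀ x y → pull a p x y ≡ pull a p y x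
pull-sym a s p x y with p x | p y
... | just i  | just j  = s i j
... | just _  | nothing = refl
... | nothing | just _  = refl
... | nothing | nothing = refl

pull-loop : ∀ {m} {X : Set} (a : Fin m → Fin m → ℕ) → (∀ i → a i i ≡ 0) →
            (p : X → Maybe (Fin m)) → ∀ x → pull a p x x ≡ 0
pull-loop a l p x with p x
... | just i  = l i
... | nothing = refl

union : ∀ {N} (a b : Fin N → Fin N → ℕ) → (∀ i j → a i j ≡ a j i) → (∀ i j → b i j ≡ b j i) →
        (∀ i → a i i ≡ 0) → (∀ i → b i i ≡ 0) → Graph
union {N} a b sa sb la lb = record
  { n = N ; adj = λ i j → a i j + b i j
  ; sym = λ i j → cong₂ _+_ (sa i j) (sb i j)
  ; loopless = λ i → cong₂ _+_ (la i) (lb i) }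

prodP₁ : ∀ k u₁ u₂ → Fin (k + (u₁ + u₂)) → Maybe (Fin (k + u₁))
prodP₁ k u₁ u₂ v with splitAt k v
... | inj₁ i = just (i ↑ˡ u₁)
... | inj₂ w with splitAt u₁ w
...   | inj₁ j = just (k ↑ʳ j)
...   | inj₂ _ = nothing

prodP₂ : ∀ k u₁ u₂ → Fin (k + (u₁ + u₂)) → Maybe (Fin (k + u₂))
prodP₂ k u₁ u₂ v with splitAt k v
... | inj₁ i = just (i ↑ˡ u₂)
... | inj₂ w with splitAt u₁ w
...   | inj₁ _ = nothing
...   | inj₂ j = just (k ↑ʳ j)

_·ᴳ_ : ∀ {k} → LGraph k → LGraph k → LGraph k
_·ᴳ_ {k} F₁ F₂ = record
  { u = u₁ + u₂
  ; adj = λ x y → pull a₁ p₁ x y + pull a₂ p₂ x y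
  ; sym = λ x y → cong₂ _+_ (pull-sym a₁ (LGraph.sym F₁) p₁ x y) (pull-sym a₂ (LGraph.sym F₂) p₂ x y)
  ; loopless = λ x → cong₂ _+_ (pull-loop a₁ (LGraph.loopless F₁) p₁ x) (pull-loop a₂ (LGraph.loopless F₂) p₂ x) }
  where
    u₁ = LGraph.u F₁
    u₂ = LGraph.u F₂
    a₁ = LGraph.adj F₁
    a₂ = LGraph.adj F₂
    p₁ = prodP₁ k u₁ u₂
    p₂ = prodP₂ k u₁ u₂

-- Concatenation of 2-labeled graphs: nodes Fin (2 + (1 + (u₁ + u₂))):
-- the two labels, then the middle node (node 2 of F₁ = node 1 of F₂,
-- unlabeled), then the unlabeled nodes of F₁, then those of F₂.

concP₁ : ∀ u₁ u₂ → Fin (2 + (1 + (u₁ + u₂))) → Maybe (Fin (2 + u₁))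
concP₁ u₁ u₂ v with splitAt 2 v
... | inj₁ zero       = just (zero ↑ˡ u₁)
... | inj₁ (suc zero) = nothing
... | inj₂ w with splitAt 1 w
...   | inj₁ _ = just (suc zero ↑ˡ u₁)
...   | inj₂ w' with splitAt u₁ w'
...     | inj₁ j = just (2 ↑ʳ j)
...     | inj₂ _ = nothing

concP₂ : ∀ u₁ u₂ → Fin (2 + (1 + (u₁ + u₂))) → Maybe (Fin (2 + u₂))
concP₂ u₁ u₂ v with splitAt 2 v
... | inj₁ zero       = nothing
... | inj₁ (suc zero) = just (suc zero ↑ˡ u₂)
... | inj₂ w with splitAt 1 w
...   | inj₁ _ = just (zero ↑ˡ u₂)
...   | inj₂ w' with splitAt u₁ w'
...     | inj₁ _ = nothing
...     | inj₂ j = just (2 ↑ʳ j)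

_∘ᴳ_ : LGraph 2 → LGraph 2 → LGraph 2
F₁ ∘ᴳ F₂ = record
  { u = 1 + (u₁ + u₂)
  ; adj = λ x y → pull a₁ p₁ x y + pull a₂ p₂ x y
  ; sym = λ x y → cong₂ _+_ (pull-sym a₁ (LGraph.sym F₁) p₁ x y) (pull-sym a₂ (LGraph.sym F₂) p₂ x y)
  ; loopless = λ x → cong₂ _+_ (pull-loop a₁ (LGraph.loopless F₁) p₁ x) (pull-loop a₂ (LGraph.loopless F₂) p₂ x) }
  where
    u₁ = LGraph.u F₁
    u₂ = LGraph.u F₂
    a₁ = LGraph.adj F₁
    a₂ = LGraph.adj F₂
    p₁ = concP₁ u₁ u₂
    p₂ = concP₂ u₁ u₂

-- 2-labeled graphs with nonadjacent labeled nodes, and the contraction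
-- F ↦ F' identifying the two labeled nodes (result: 1-labeled graph,
-- nodes Fin (1 + u), node 0 = the merged labeled node).

Nonadj2 : LGraph 2 → Set
Nonadj2 F = LGraph.adj F (zero ↑ˡ LGraph.u F) (suc zero ↑ˡ LGraph.u F) ≡ 0

contrAdj : ∀ {u} → (Fin (2 + u) → Fin (2 + u) → ℕ) → Fin (1 + u) → Fin (1 + u) → ℕ
contrAdj {u} a x y with splitAt 1 x | splitAt 1 y
... | inj₁ _ | inj₁ _ = 0
... | inj₁ _ | inj₂ j = a (zero ↑ˡ u) (2 ↑ʳ j) + a (suc zero ↑ˡ u) (2 ↑ʳ j)
... | inj₂ i | inj₁ _ = a (2 ↑ʳ i) (zero ↑ˡ u) + a (2 ↑ʳ i) (suc zero ↑ˡ u)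
... | inj₂ i | inj₂ j = a (2 ↑ʳ i) (2 ↑ʳ j)

contrAdj-sym : ∀ {u} (a : Fin (2 + u) → Fin (2 + u) → ℕ) → (∀ i j → a i j ≡ a j i) →
               ∀ x y → contrAdj a x y ≡ contrAdj a y x
contrAdj-sym {u} a s x y with splitAt 1 x | splitAt 1 y
... | inj₁ _ | inj₁ _ = refl
... | inj₁ _ | inj₂ j = cong₂ _+_ (s _ _) (s _ _)
... | inj₂ i | inj₁ _ = cong₂ _+_ (s _ _) (s _ _)
... | inj₂ i | inj₂ j = s _ _

contrAdj-loop : ∀ {u} (a : Fin (2 + u) → Fin (2 + u) → ℕ) → (∀ i → a i i ≡ 0) →
                ∀ x → contrAdj a x x ≡ 0
contrAdj-loop {u} a l x with splitAt 1 x
... | inj₁ _ = refl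
... | inj₂ i = l _

contract : (F : LGraph 2) → Nonadj2 F → LGraph 1
contract F _ = record
  { u = LGraph.u F
  ; adj = contrAdj (LGraph.adj F)
  ; sym = contrAdj-sym (LGraph.adj F) (LGraph.sym F)
  ; loopless = contrAdj-loop (LGraph.adj F) (LGraph.loopless F) }

-- Quantum graphs over a commutative ring R of scalars (the paper: ℝ).

module _ {c ℓ} (R : CommutativeRing c ℓ) where
  open CommutativeRing R using (_≈_; _*_; -_; 0#) renaming (Carrier to K; _+_ to _+ᴷ_)

  GraphParameter : Set (c ⊔ ℓ)
  GraphParameter = Σ (Graph → K) λ f → ∀ G H → G ≅ H → f G ≈ f H

  QG : ℕ → Set c
  QG k = List (K × LGraph k)

  QG0 : Set c
  QG0 = List (K × Σ (LGraph 2) Nonadj2)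

  embed0 : QG0 → QG 2
  embed0 = map (λ t → proj₁ t , proj₁ (proj₂ t))

  contractQ : QG0 → QG 1
  contractQ = map (λ t → proj₁ t , contract (proj₁ (proj₂ t)) (proj₂ (proj₂ t)))

  _⊕_ : ∀ {k} → QG k → QG k → QG k
  x ⊕ y = x ++ y

  _⊙_ : ∀ {k} → K → QG k → QG k
  a ⊙ x = map (λ t → a * proj₁ t , proj₂ t) x

  ⊖_ : ∀ {k} → QG k → QG k
  ⊖ x = map (λ t → - proj₁ t , proj₂ t) x

  _·Q_ : ∀ {k} → QG k → QG k → QG k
  x ·Q y = concatMap (λ s → map (λ t → proj₁ s * proj₁ t , proj₂ s ·ᴳ proj₂ t) y) x

  _∘Q_ : QG 2 → QG 2 → QG 2
  x ∘Q y = concatMap (λ s → map (λ t → proj₁ s * proj₁ t , proj₂ s ∘ᴳ proj₂ t) y) x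

  evalQ : ∀ {k} → GraphParameter → QG k → K
  evalQ f []            = 0#
  evalQ f ((a , F) ∷ x) = a * proj₁ f (forget F) +ᴷ evalQ f x

  InN : ∀ {k} → GraphParameter → QG k → Set (c ⊔ ℓ)
  InN {k} f x = (y : QG k) → evalQ f (x ·Q y) ≈ 0#

  EqMod : ∀ {k} → GraphParameter → QG k → QG k → Set (c ⊔ ℓ)
  EqMod f x y = InN f (x ⊕ (⊖ y))

  IsContractor : GraphParameter → QG 2 → Set (c ⊔ ℓ)
  IsContractor f z = (x : QG0) → evalQ f (embed0 x ·Q z) ≈ evalQ f (contractQ x)

{-# OPTIONS --safe #-}
module Submission where

-- Write ⟪ x , w ⟫ = f (x w) for 2-labeled quantum graphs; then x ≡ y (mod f)
-- exactly when ⟪ x , _ ⟫ = ⟪ y , _ ⟫.  Gluing gives (F₁ ∘ F₂) W ≅ F₁ (W ∘ F₂*)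
-- ≅ F₂ (F₁* ∘ W), where F* swaps the two labels, so either factor of a
-- concatenation can be moved into the other argument of ⟪_,_⟫; this makes ∘
-- well defined on G₂/f, and associativity and bilinearity hold termwise.  For
-- the unit, ⟪ z ∘ x , w ⟫ = ⟪ w ∘ x* , z ⟫, and w ∘ x* has nonadjacent labels,
-- so the contractor turns this into f ((w ∘ x*)′) = f (x w); symmetrically on
-- the right.
--
-- Graph isomorphisms are built from presentations: a graph is described on an
-- arbitrary node type in bijection with Fin n, so that products and
-- concatenations are sums of adjacencies pulled back along partial maps, and
-- each isomorphism is a permutation of a nested sum type.

open import Defs
open import Data.Product using (_×_; _,_)
open import Algebra.Bundles using (CommutativeRing)

module GraphIsomorphisms where

  open import Data.Nat using (ℕ; zero; suc; _+_)
  import Data.Nat.Properties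
  open import Data.Nat.Properties using (+-comm; +-assoc; +-identityʳ)
  open import Data.Fin using (Fin; zero; suc; splitAt)
  open import Data.Fin.Properties using (+↔⊎; splitAt-↑ˡ; splitAt-↑ʳ)
  open import Data.Sum using (_⊎_; inj₁; inj₂)
  open import Data.Sum.Function.Propositional using (_⊎-↔_)
  open import Data.Sum.Algebra using (⊎-comm)
  open import Data.Maybe using (Maybe; just; nothing; _>>=_)
  import Data.Maybe as Maybe
  open import Data.Product using (proj₁; proj₂)
  open import Function using (_∘_)
  open import Function.Bundles using (_↔_; Inverse; mk↔ₛ′)
  open import Function.Properties.Inverse using (↔-refl; ↔-sym; ↔-trans)
  open import Relation.Binary.PropositionalEquality
  open import Algebra.Properties.CommutativeSemigroup Data.Nat.Properties.+-commutativeSemigroup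
    using (x∙yz≈xz∙y; x∙yz≈yx∙z)
  open Inverse using (to; from; strictlyInverseˡ; strictlyInverseʳ)

  -- Adjacency functions pulled back along partial maps

  Adj : Set → Set
  Adj X = X → X → ℕ

  infixl 6 _+ᴬ_
  infix  8 _⟨_⟩

  _+ᴬ_ : ∀ {X} → Adj X → Adj X → Adj X
  (A +ᴬ B) x y = A x y + B x y

  _⁺ : ∀ {X} → Adj X → Adj (Maybe X)
  (A ⁺) (just x) (just y) = A x y
  (A ⁺) (just x) nothing  = 0
  (A ⁺) nothing  _        = 0

  _⟨_⟩ : ∀ {X Y} → Adj Y → (X → Maybe Y) → Adj X
  (A ⟨ p ⟩) x y = (A ⁺) (p x) (p y)

  _>=>_ : ∀ {X Y Z : Set} → (X → Maybe Y) → (Y → Maybe Z) → X → Maybe Z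
  (r >=> p) x = r x >>= p

  ⁺-nothingʳ : ∀ {X} (A : Adj X) (m : Maybe X) → (A ⁺) m nothing ≡ 0
  ⁺-nothingʳ A (just x) = refl
  ⁺-nothingʳ A nothing  = refl

  module _ {X Y : Set} where

    ⟨⟩-+ᴬ : (A B : Adj Y) (p : X → Maybe Y) →
            ∀ x y → ((A +ᴬ B) ⟨ p ⟩) x y ≡ (A ⟨ p ⟩) x y + (B ⟨ p ⟩) x y
    ⟨⟩-+ᴬ A B p x y with p x | p y
    ... | just _  | just _  = refl
    ... | just _  | nothing = refl
    ... | nothing | _       = refl

    ⟨⟩-cong : (A : Adj Y) {p q : X → Maybe Y} → (∀ x → p x ≡ q x) →
              ∀ x y → (A ⟨ p ⟩) x y ≡ (A ⟨ q ⟩) x y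
    ⟨⟩-cong A p≗q x y = cong₂ (A ⁺) (p≗q x) (p≗q y)

  ⟨⟩-⟨⟩ : ∀ {X Y Z : Set} (A : Adj Z) (p : Y → Maybe Z) (r : X → Maybe Y) →
          ∀ x y → ((A ⟨ p ⟩) ⟨ r ⟩) x y ≡ (A ⟨ r >=> p ⟩) x y
  ⟨⟩-⟨⟩ A p r x y with r x | r y
  ... | just a  | just b  = refl
  ... | just a  | nothing = sym (⁺-nothingʳ A (p a))
  ... | nothing | _       = refl

  pull≡⟨⟩ : ∀ {m} {X Y : Set} {a : Adj (Fin m)} {A : Adj Y} (g : Fin m → Y) →
            (∀ i j → a i j ≡ A (g i) (g j)) →
            (p : X → Maybe (Fin m)) {r : X → Maybe Y} → (∀ x → Maybe.map g (p x) ≡ r x) →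
            ∀ x y → pull a p x y ≡ (A ⟨ r ⟩) x y
  pull≡⟨⟩ g a≡A p {r} p≗r x y with p x | p y | r x | r y | p≗r x | p≗r y
  ... | just i  | just j  | _ | _ | refl | refl = a≡A i j
  ... | just i  | nothing | _ | _ | refl | refl = refl
  ... | nothing | _       | _ | _ | refl | refl = refl

  ⟨⟩-+ᴬ-⟨⟩ : ∀ {X Y Z₁ Z₂ : Set} (A : Adj Z₁) (p : Y → Maybe Z₁) (B : Adj Z₂) (q : Y → Maybe Z₂)
             (r : X → Maybe Y) →
             ∀ x y → ((A ⟨ p ⟩ +ᴬ B ⟨ q ⟩) ⟨ r ⟩) x y ≡ (A ⟨ r >=> p ⟩) x y + (B ⟨ r >=> q ⟩) x y
  ⟨⟩-+ᴬ-⟨⟩ A p B q r x y =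
    trans (⟨⟩-+ᴬ (A ⟨ p ⟩) (B ⟨ q ⟩) r x y) (cong₂ _+_ (⟨⟩-⟨⟩ A p r x y) (⟨⟩-⟨⟩ B q r x y))

  -- Presentations of graphs on arbitrary node types

  record Presentation (G : Graph) : Set₁ where
    field
      Node        : Set
      node        : Fin (Graph.n G) ↔ Node
      adj         : Adj Node
      adj-correct : ∀ i j → Graph.adj G i j ≡ adj (to node i) (to node j)

  ≅-via : ∀ {G H} (P : Presentation G) (Q : Presentation H) (ρ : Presentation.Node P ↔ Presentation.Node Q) →
          (∀ s t → Presentation.adj Q (to ρ s) (to ρ t) ≡ Presentation.adj P s t) → G ≅ H
  ≅-via {G} {H} P Q ρ ρ-adj = π , π-adj
    where
      module P = Presentation P
      module Q = Presentation Q
      open ≡-Reasoning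
      π : Fin (Graph.n G) ↔ Fin (Graph.n H)
      π = ↔-trans P.node (↔-trans ρ (↔-sym Q.node))
      π-adj : ∀ i j → Graph.adj H (to π i) (to π j) ≡ Graph.adj G i j
      π-adj i j = begin
        Graph.adj H (to π i) (to π j)
          ≡⟨ Q.adj-correct (to π i) (to π j) ⟩
        Q.adj (to Q.node (to π i)) (to Q.node (to π j))
          ≡⟨ cong₂ Q.adj (strictlyInverseˡ Q.node _) (strictlyInverseˡ Q.node _) ⟩
        Q.adj (to ρ (to P.node i)) (to ρ (to P.node j))
          ≡⟨ ρ-adj (to P.node i) (to P.node j) ⟩
        P.adj (to P.node i) (to P.node j)
          ≡⟨ P.adj-correct i j ⟨
        Graph.adj G i j ∎

  labeledNodes : ∀ {k u} {U : Set} → Fin u ↔ U → Fin (k + u) ↔ (Fin k ⊎ U)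
  labeledNodes τ = ↔-trans +↔⊎ (↔-refl ⊎-↔ τ)

  record LPresentation {k} (F : LGraph k) : Set₁ where
    field
      Unlabeled   : Set
      unlabeled   : Fin (LGraph.u F) ↔ Unlabeled
      adj         : Adj (Fin k ⊎ Unlabeled)
      adj-correct : ∀ x y → LGraph.adj F x y ≡ adj (to (labeledNodes unlabeled) x) (to (labeledNodes unlabeled) y)

    node : Fin (k + LGraph.u F) → Fin k ⊎ Unlabeled
    node = to (labeledNodes unlabeled)

    adj-loopless : ∀ s → adj s s ≡ 0
    adj-loopless s = begin
      adj s s                 ≡⟨ cong₂ adj (strictlyInverseˡ σ s) (strictlyInverseˡ σ s) ⟨
      adj (node i) (node i)   ≡⟨ adj-correct i i ⟨
      LGraph.adj F i i        ≡⟨ LGraph.loopless F i ⟩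
      0                       ∎
      where
        open ≡-Reasoning
        σ : Fin (k + LGraph.u F) ↔ (Fin k ⊎ Unlabeled)
        σ = labeledNodes unlabeled
        i : Fin (k + LGraph.u F)
        i = from σ s

  forgetᴾ : ∀ {k} {F : LGraph k} → LPresentation F → Presentation (forget F)
  forgetᴾ P = record
    { Node = Fin _ ⊎ Unlabeled ; node = labeledNodes unlabeled ; adj = adj ; adj-correct = adj-correct }
    where open LPresentation P

  canonicalᴾ : ∀ {k} (F : LGraph k) → LPresentation F
  canonicalᴾ {k} F = record
    { Unlabeled = Fin (LGraph.u F)
    ; unlabeled = ↔-refl
    ; adj = λ s t → LGraph.adj F (from σ s) (from σ t)
    ; adj-correct = λ x y → cong₂ (LGraph.adj F) (sym (strictlyInverseʳ σ x)) (sym (strictlyInverseʳ σ y)) }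
    where
      σ : Fin (k + LGraph.u F) ↔ (Fin k ⊎ Fin (LGraph.u F))
      σ = labeledNodes ↔-refl

  module _ {k : ℕ} {U₁ U₂ : Set} where

    factor₁ : Fin k ⊎ (U₁ ⊎ U₂) → Maybe (Fin k ⊎ U₁)
    factor₁ (inj₁ i)        = just (inj₁ i)
    factor₁ (inj₂ (inj₁ a)) = just (inj₂ a)
    factor₁ (inj₂ (inj₂ b)) = nothing

    factor₂ : Fin k ⊎ (U₁ ⊎ U₂) → Maybe (Fin k ⊎ U₂)
    factor₂ (inj₁ i)        = just (inj₁ i)
    factor₂ (inj₂ (inj₁ a)) = nothing
    factor₂ (inj₂ (inj₂ b)) = just (inj₂ b)

  _·ᴾ_ : ∀ {k} {F₁ F₂ : LGraph k} → LPresentation F₁ → LPresentation F₂ → LPresentation (F₁ ·ᴳ F₂)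
  _·ᴾ_ {k} {F₁} {F₂} P₁ P₂ = record
    { Unlabeled = P₁.Unlabeled ⊎ P₂.Unlabeled
    ; unlabeled = ↔-trans +↔⊎ (P₁.unlabeled ⊎-↔ P₂.unlabeled)
    ; adj = P₁.adj ⟨ factor₁ ⟩ +ᴬ P₂.adj ⟨ factor₂ ⟩
    ; adj-correct = λ x y → cong₂ _+_ (pull≡⟨⟩ P₁.node P₁.adj-correct (prodP₁ k u₁ u₂) factor₁-correct x y)
                                      (pull≡⟨⟩ P₂.node P₂.adj-correct (prodP₂ k u₁ u₂) factor₂-correct x y) }
    where
      module P₁ = LPresentation P₁
      module P₂ = LPresentation P₂
      u₁ u₂ : ℕ
      u₁ = LGraph.u F₁
      u₂ = LGraph.u F₂
      node : Fin (k + (u₁ + u₂)) → Fin k ⊎ (P₁.Unlabeled ⊎ P₂.Unlabeled)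
      node = to (labeledNodes (↔-trans +↔⊎ (P₁.unlabeled ⊎-↔ P₂.unlabeled)))
      factor₁-correct : ∀ x → Maybe.map P₁.node (prodP₁ k u₁ u₂ x) ≡ factor₁ (node x)
      factor₁-correct x with splitAt k x
      ... | inj₁ i rewrite splitAt-↑ˡ k i u₁ = refl
      ... | inj₂ w with splitAt u₁ w
      ...   | inj₁ j rewrite splitAt-↑ʳ k u₁ j = refl
      ...   | inj₂ j = refl
      factor₂-correct : ∀ x → Maybe.map P₂.node (prodP₂ k u₁ u₂ x) ≡ factor₂ (node x)
      factor₂-correct x with splitAt k x
      ... | inj₁ i rewrite splitAt-↑ˡ k i u₂ = refl
      ... | inj₂ w with splitAt u₁ w
      ...   | inj₁ j = refl
      ...   | inj₂ j rewrite splitAt-↑ʳ k u₂ j = refl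

  module _ {U₁ U₂ : Set} where

    segment₁ : Fin 2 ⊎ (Fin 1 ⊎ (U₁ ⊎ U₂)) → Maybe (Fin 2 ⊎ U₁)
    segment₁ (inj₁ zero)                = just (inj₁ zero)
    segment₁ (inj₁ (suc zero))          = nothing
    segment₁ (inj₂ (inj₁ _))            = just (inj₁ (suc zero))
    segment₁ (inj₂ (inj₂ (inj₁ a)))     = just (inj₂ a)
    segment₁ (inj₂ (inj₂ (inj₂ b)))     = nothing

    segment₂ : Fin 2 ⊎ (Fin 1 ⊎ (U₁ ⊎ U₂)) → Maybe (Fin 2 ⊎ U₂)
    segment₂ (inj₁ zero)                = nothing
    segment₂ (inj₁ (suc zero))          = just (inj₁ (suc zero))
    segment₂ (inj₂ (inj₁ _))            = just (inj₁ zero)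
    segment₂ (inj₂ (inj₂ (inj₁ a)))     = nothing
    segment₂ (inj₂ (inj₂ (inj₂ b)))     = just (inj₂ b)

  _∘ᴾ_ : ∀ {F₁ F₂ : LGraph 2} → LPresentation F₁ → LPresentation F₂ → LPresentation (F₁ ∘ᴳ F₂)
  _∘ᴾ_ {F₁} {F₂} P₁ P₂ = record
    { Unlabeled = Fin 1 ⊎ (P₁.Unlabeled ⊎ P₂.Unlabeled)
    ; unlabeled = τ
    ; adj = P₁.adj ⟨ segment₁ ⟩ +ᴬ P₂.adj ⟨ segment₂ ⟩
    ; adj-correct = λ x y → cong₂ _+_ (pull≡⟨⟩ P₁.node P₁.adj-correct (concP₁ u₁ u₂) segment₁-correct x y)
                                      (pull≡⟨⟩ P₂.node P₂.adj-correct (concP₂ u₁ u₂) segment₂-correct x y) }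
    where
      module P₁ = LPresentation P₁
      module P₂ = LPresentation P₂
      u₁ u₂ : ℕ
      u₁ = LGraph.u F₁
      u₂ = LGraph.u F₂
      τ : Fin (1 + (u₁ + u₂)) ↔ (Fin 1 ⊎ (P₁.Unlabeled ⊎ P₂.Unlabeled))
      τ = labeledNodes (↔-trans +↔⊎ (P₁.unlabeled ⊎-↔ P₂.unlabeled))
      node : Fin (2 + (1 + (u₁ + u₂))) → Fin 2 ⊎ (Fin 1 ⊎ (P₁.Unlabeled ⊎ P₂.Unlabeled))
      node = to (labeledNodes τ)
      segment₁-correct : ∀ x → Maybe.map P₁.node (concP₁ u₁ u₂ x) ≡ segment₁ (node x)
      segment₁-correct zero                = refl
      segment₁-correct (suc zero)          = refl
      segment₁-correct (suc (suc zero))    = refl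
      segment₁-correct (suc (suc (suc w))) with splitAt u₁ w
      ... | inj₁ _ = refl
      ... | inj₂ _ = refl
      segment₂-correct : ∀ x → Maybe.map P₂.node (concP₂ u₁ u₂ x) ≡ segment₂ (node x)
      segment₂-correct zero                = refl
      segment₂-correct (suc zero)          = refl
      segment₂-correct (suc (suc zero))    = refl
      segment₂-correct (suc (suc (suc w))) with splitAt u₁ w
      ... | inj₁ _ = refl
      ... | inj₂ _ = refl

  swapLabels : ∀ {u} → Fin (2 + u) → Fin (2 + u)
  swapLabels zero          = suc zero
  swapLabels (suc zero)    = zero
  swapLabels (suc (suc w)) = suc (suc w)

  reverseᴳ : LGraph 2 → LGraph 2
  reverseᴳ F = record
    { u = LGraph.u F
    ; adj = λ x y → LGraph.adj F (swapLabels x) (swapLabels y)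
    ; sym = λ x y → LGraph.sym F (swapLabels x) (swapLabels y)
    ; loopless = λ x → LGraph.loopless F (swapLabels x) }

  swapLabelsᴹ : ∀ {U : Set} → Fin 2 ⊎ U → Maybe (Fin 2 ⊎ U)
  swapLabelsᴹ (inj₁ zero)       = just (inj₁ (suc zero))
  swapLabelsᴹ (inj₁ (suc zero)) = just (inj₁ zero)
  swapLabelsᴹ (inj₂ a)          = just (inj₂ a)

  reverseᴾ : ∀ {F : LGraph 2} → LPresentation F → LPresentation (reverseᴳ F)
  reverseᴾ P = record
    { Unlabeled = Unlabeled
    ; unlabeled = unlabeled
    ; adj = adj ⟨ swapLabelsᴹ ⟩
    ; adj-correct = λ x y → trans (adj-correct (swapLabels x) (swapLabels y))
                                  (cong₂ (adj ⁺) (swap-correct x) (swap-correct y)) }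
    where
      open LPresentation P
      swap-correct : ∀ x → just (node (swapLabels x)) ≡ swapLabelsᴹ (node x)
      swap-correct zero          = refl
      swap-correct (suc zero)    = refl
      swap-correct (suc (suc w)) = refl

  ∘ᴳ-nonadj : ∀ F₁ F₂ → Nonadj2 (F₁ ∘ᴳ F₂)
  ∘ᴳ-nonadj F₁ F₂ = refl

  module _ {U₁ U₂ : Set} where

    merged₁ : Fin 1 ⊎ (Fin 1 ⊎ (U₁ ⊎ U₂)) → Maybe (Fin 2 ⊎ U₁)
    merged₁ (inj₁ _) = just (inj₁ zero)
    merged₁ (inj₂ t) = segment₁ {U₁} {U₂} (inj₂ t)

    merged₂ : Fin 1 ⊎ (Fin 1 ⊎ (U₁ ⊎ U₂)) → Maybe (Fin 2 ⊎ U₂)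
    merged₂ (inj₁ _) = just (inj₁ (suc zero))
    merged₂ (inj₂ t) = segment₂ {U₁} {U₂} (inj₂ t)

  contract-∘ᴾ : ∀ {F₁ F₂ : LGraph 2} → LPresentation F₁ → LPresentation F₂ →
                LPresentation (contract (F₁ ∘ᴳ F₂) (∘ᴳ-nonadj F₁ F₂))
  contract-∘ᴾ {F₁} {F₂} P₁ P₂ = record
    { Unlabeled = C.Unlabeled
    ; unlabeled = C.unlabeled
    ; adj = P₁.adj ⟨ merged₁ ⟩ +ᴬ P₂.adj ⟨ merged₂ ⟩
    ; adj-correct = adj-correct }
    where
      module P₁ = LPresentation P₁
      module P₂ = LPresentation P₂
      C : LPresentation (F₁ ∘ᴳ F₂)
      C = P₁ ∘ᴾ P₂
      module C = LPresentation C
      open ≡-Reasoning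
      a : Adj (Fin (2 + LGraph.u (F₁ ∘ᴳ F₂)))
      a = LGraph.adj (F₁ ∘ᴳ F₂)
      σ : Fin (1 + LGraph.u (F₁ ∘ᴳ F₂)) → Fin 1 ⊎ C.Unlabeled
      σ = to (labeledNodes C.unlabeled)
      -- Label 0 of F₁ ∘ᴳ F₂ lies only in F₁ and label 1 only in F₂, so the cross terms vanish.
      adj-correct : ∀ x y → contrAdj a x y ≡ (P₁.adj ⟨ merged₁ ⟩ +ᴬ P₂.adj ⟨ merged₂ ⟩) (σ x) (σ y)
      adj-correct zero zero = sym (cong₂ _+_ (P₁.adj-loopless (inj₁ zero)) (P₂.adj-loopless (inj₁ (suc zero))))
      adj-correct zero (suc w) = begin
        a zero (suc (suc w)) + a (suc zero) (suc (suc w))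
          ≡⟨ cong₂ _+_ (C.adj-correct zero (suc (suc w))) (C.adj-correct (suc zero) (suc (suc w))) ⟩
        (x + 0) + y
          ≡⟨ cong (_+ y) (+-identityʳ x) ⟩
        x + y ∎
        where
          t : Fin 2 ⊎ C.Unlabeled
          t = C.node (suc (suc w))
          x y : ℕ
          x = (P₁.adj ⁺) (just (inj₁ zero)) (segment₁ t)
          y = (P₂.adj ⁺) (just (inj₁ (suc zero))) (segment₂ t)
      adj-correct (suc v) zero = begin
        a (suc (suc v)) zero + a (suc (suc v)) (suc zero)
          ≡⟨ cong₂ _+_ (C.adj-correct (suc (suc v)) zero) (C.adj-correct (suc (suc v)) (suc zero)) ⟩
        (x + (P₂.adj ⁺) (segment₂ t) nothing) + ((P₁.adj ⁺) (segment₁ t) nothing + y)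
          ≡⟨ cong₂ (λ m n → (x + m) + (n + y)) (⁺-nothingʳ P₂.adj (segment₂ t)) (⁺-nothingʳ P₁.adj (segment₁ t)) ⟩
        (x + 0) + y
          ≡⟨ cong (_+ y) (+-identityʳ x) ⟩
        x + y ∎
        where
          t : Fin 2 ⊎ C.Unlabeled
          t = C.node (suc (suc v))
          x y : ℕ
          x = (P₁.adj ⁺) (segment₁ t) (just (inj₁ zero))
          y = (P₂.adj ⁺) (segment₂ t) (just (inj₁ (suc zero)))
      adj-correct (suc v) (suc w) = C.adj-correct (suc (suc v)) (suc (suc w))

  -- Isomorphisms between glued graphs

  module _ {U₁ U₂ V : Set} where

    private
      S T : Set
      S = Fin 2 ⊎ ((Fin 1 ⊎ (U₁ ⊎ U₂)) ⊎ V)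
      T = Fin 2 ⊎ (U₁ ⊎ (Fin 1 ⊎ (V ⊎ U₂)))

    moveʳ-to : S → T
    moveʳ-to (inj₁ zero)                        = inj₁ zero
    moveʳ-to (inj₁ (suc zero))                  = inj₂ (inj₂ (inj₁ zero))
    moveʳ-to (inj₂ (inj₁ (inj₁ zero)))          = inj₁ (suc zero)
    moveʳ-to (inj₂ (inj₁ (inj₂ (inj₁ a))))      = inj₂ (inj₁ a)
    moveʳ-to (inj₂ (inj₁ (inj₂ (inj₂ b))))      = inj₂ (inj₂ (inj₂ (inj₂ b)))
    moveʳ-to (inj₂ (inj₂ w))                    = inj₂ (inj₂ (inj₂ (inj₁ w)))

    moveʳ-from : T → S
    moveʳ-from (inj₁ zero)                      = inj₁ zero
    moveʳ-from (inj₂ (inj₂ (inj₁ zero)))        = inj₁ (suc zero)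
    moveʳ-from (inj₁ (suc zero))                = inj₂ (inj₁ (inj₁ zero))
    moveʳ-from (inj₂ (inj₁ a))                  = inj₂ (inj₁ (inj₂ (inj₁ a)))
    moveʳ-from (inj₂ (inj₂ (inj₂ (inj₂ b))))    = inj₂ (inj₁ (inj₂ (inj₂ b)))
    moveʳ-from (inj₂ (inj₂ (inj₂ (inj₁ w))))    = inj₂ (inj₂ w)

    moveʳ : S ↔ T
    moveʳ = mk↔ₛ′ moveʳ-to moveʳ-from to∘from from∘to
      where
        to∘from : ∀ t → moveʳ-to (moveʳ-from t) ≡ t
        to∘from (inj₁ zero)                   = refl
        to∘from (inj₂ (inj₂ (inj₁ zero)))     = refl
        to∘from (inj₁ (suc zero))             = refl
        to∘from (inj₂ (inj₁ a))               = refl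
        to∘from (inj₂ (inj₂ (inj₂ (inj₂ b)))) = refl
        to∘from (inj₂ (inj₂ (inj₂ (inj₁ w)))) = refl
        from∘to : ∀ s → moveʳ-from (moveʳ-to s) ≡ s
        from∘to (inj₁ zero)                   = refl
        from∘to (inj₁ (suc zero))             = refl
        from∘to (inj₂ (inj₁ (inj₁ zero)))     = refl
        from∘to (inj₂ (inj₁ (inj₂ (inj₁ a)))) = refl
        from∘to (inj₂ (inj₁ (inj₂ (inj₂ b)))) = refl
        from∘to (inj₂ (inj₂ w))               = refl

    moveʳ-pieces : ∀ s → factor₁ (moveʳ-to s) ≡ (factor₁ >=> segment₁) s
                       × (factor₂ >=> segment₁) (moveʳ-to s) ≡ factor₂ s
                       × ((factor₂ >=> segment₂) >=> swapLabelsᴹ) (moveʳ-to s) ≡ (factor₁ >=> segment₂) s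
    moveʳ-pieces (inj₁ zero)                   = refl , refl , refl
    moveʳ-pieces (inj₁ (suc zero))             = refl , refl , refl
    moveʳ-pieces (inj₂ (inj₁ (inj₁ zero)))     = refl , refl , refl
    moveʳ-pieces (inj₂ (inj₁ (inj₂ (inj₁ a)))) = refl , refl , refl
    moveʳ-pieces (inj₂ (inj₁ (inj₂ (inj₂ b)))) = refl , refl , refl
    moveʳ-pieces (inj₂ (inj₂ w))               = refl , refl , refl

  ∘ᴳ-·ᴳ-moveʳ : ∀ F₁ F₂ W → forget ((F₁ ∘ᴳ F₂) ·ᴳ W) ≅ forget (F₁ ·ᴳ (W ∘ᴳ reverseᴳ F₂))
  ∘ᴳ-·ᴳ-moveʳ F₁ F₂ W =
    ≅-via (forgetᴾ ((P₁ ∘ᴾ P₂) ·ᴾ Q)) (forgetᴾ (P₁ ·ᴾ (Q ∘ᴾ reverseᴾ P₂))) moveʳ adj-moveʳ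
    where
      P₁ : LPresentation F₁
      P₁ = canonicalᴾ F₁
      P₂ : LPresentation F₂
      P₂ = canonicalᴾ F₂
      Q  : LPresentation W
      Q  = canonicalᴾ W
      module P₁ = LPresentation P₁
      module P₂ = LPresentation P₂
      module Q  = LPresentation Q
      open ≡-Reasoning
      adj-moveʳ : ∀ s t → LPresentation.adj (P₁ ·ᴾ (Q ∘ᴾ reverseᴾ P₂)) (moveʳ-to s) (moveʳ-to t)
                        ≡ LPresentation.adj ((P₁ ∘ᴾ P₂) ·ᴾ Q) s t
      adj-moveʳ s t = begin
        _ ≡⟨ cong₂ _+_ (⟨⟩-cong P₁.adj (proj₁ ∘ moveʳ-pieces) s t)
                       (trans (⟨⟩-+ᴬ-⟨⟩ Q.adj segment₁ (P₂.adj ⟨ swapLabelsᴹ ⟩) segment₂ factor₂ s′ t′)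
                              (cong₂ _+_ (⟨⟩-cong Q.adj (proj₁ ∘ proj₂ ∘ moveʳ-pieces) s t)
                                         (trans (⟨⟩-⟨⟩ P₂.adj swapLabelsᴹ (factor₂ >=> segment₂) s′ t′)
                                                (⟨⟩-cong P₂.adj (proj₂ ∘ proj₂ ∘ moveʳ-pieces) s t)))) ⟩
        a₁ + (b + a₂) ≡⟨ x∙yz≈xz∙y a₁ b a₂ ⟩
        (a₁ + a₂) + b ≡⟨ cong (_+ b) (⟨⟩-+ᴬ-⟨⟩ P₁.adj segment₁ P₂.adj segment₂ factor₁ s t) ⟨
        _ ∎
        where
          s′ t′ : Fin 2 ⊎ (P₁.Unlabeled ⊎ (Fin 1 ⊎ (Q.Unlabeled ⊎ P₂.Unlabeled)))
          s′ = moveʳ-to s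
          t′ = moveʳ-to t
          a₁ a₂ b : ℕ
          a₁ = (P₁.adj ⟨ factor₁ >=> segment₁ ⟩) s t
          a₂ = (P₂.adj ⟨ factor₁ >=> segment₂ ⟩) s t
          b  = (Q.adj ⟨ factor₂ ⟩) s t

  module _ {U₁ U₂ V : Set} where

    private
      S T : Set
      S = Fin 2 ⊎ ((Fin 1 ⊎ (U₁ ⊎ U₂)) ⊎ V)
      T = Fin 2 ⊎ (U₂ ⊎ (Fin 1 ⊎ (U₁ ⊎ V)))

    moveˡ-to : S → T
    moveˡ-to (inj₁ zero)                        = inj₂ (inj₂ (inj₁ zero))
    moveˡ-to (inj₁ (suc zero))                  = inj₁ (suc zero)
    moveˡ-to (inj₂ (inj₁ (inj₁ zero)))          = inj₁ zero
    moveˡ-to (inj₂ (inj₁ (inj₂ (inj₁ a))))      = inj₂ (inj₂ (inj₂ (inj₁ a)))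
    moveˡ-to (inj₂ (inj₁ (inj₂ (inj₂ b))))      = inj₂ (inj₁ b)
    moveˡ-to (inj₂ (inj₂ w))                    = inj₂ (inj₂ (inj₂ (inj₂ w)))

    moveˡ-from : T → S
    moveˡ-from (inj₂ (inj₂ (inj₁ zero)))        = inj₁ zero
    moveˡ-from (inj₁ (suc zero))                = inj₁ (suc zero)
    moveˡ-from (inj₁ zero)                      = inj₂ (inj₁ (inj₁ zero))
    moveˡ-from (inj₂ (inj₂ (inj₂ (inj₁ a))))    = inj₂ (inj₁ (inj₂ (inj₁ a)))
    moveˡ-from (inj₂ (inj₁ b))                  = inj₂ (inj₁ (inj₂ (inj₂ b)))
    moveˡ-from (inj₂ (inj₂ (inj₂ (inj₂ w))))    = inj₂ (inj₂ w)

    moveˡ : S ↔ T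
    moveˡ = mk↔ₛ′ moveˡ-to moveˡ-from to∘from from∘to
      where
        to∘from : ∀ t → moveˡ-to (moveˡ-from t) ≡ t
        to∘from (inj₂ (inj₂ (inj₁ zero)))     = refl
        to∘from (inj₁ (suc zero))             = refl
        to∘from (inj₁ zero)                   = refl
        to∘from (inj₂ (inj₂ (inj₂ (inj₁ a)))) = refl
        to∘from (inj₂ (inj₁ b))               = refl
        to∘from (inj₂ (inj₂ (inj₂ (inj₂ w)))) = refl
        from∘to : ∀ s → moveˡ-from (moveˡ-to s) ≡ s
        from∘to (inj₁ zero)                   = refl
        from∘to (inj₁ (suc zero))             = refl
        from∘to (inj₂ (inj₁ (inj₁ zero)))     = refl
        from∘to (inj₂ (inj₁ (inj₂ (inj₁ a)))) = refl
        from∘to (inj₂ (inj₁ (inj₂ (inj₂ b)))) = refl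
        from∘to (inj₂ (inj₂ w))               = refl

    moveˡ-pieces : ∀ s → factor₁ (moveˡ-to s) ≡ (factor₁ >=> segment₂) s
                       × ((factor₂ >=> segment₁) >=> swapLabelsᴹ) (moveˡ-to s) ≡ (factor₁ >=> segment₁) s
                       × (factor₂ >=> segment₂) (moveˡ-to s) ≡ factor₂ s
    moveˡ-pieces (inj₁ zero)                   = refl , refl , refl
    moveˡ-pieces (inj₁ (suc zero))             = refl , refl , refl
    moveˡ-pieces (inj₂ (inj₁ (inj₁ zero)))     = refl , refl , refl
    moveˡ-pieces (inj₂ (inj₁ (inj₂ (inj₁ a)))) = refl , refl , refl
    moveˡ-pieces (inj₂ (inj₁ (inj₂ (inj₂ b)))) = refl , refl , refl
    moveˡ-pieces (inj₂ (inj₂ w))               = refl , refl , refl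

  ∘ᴳ-·ᴳ-moveˡ : ∀ F₁ F₂ W → forget ((F₁ ∘ᴳ F₂) ·ᴳ W) ≅ forget (F₂ ·ᴳ (reverseᴳ F₁ ∘ᴳ W))
  ∘ᴳ-·ᴳ-moveˡ F₁ F₂ W =
    ≅-via (forgetᴾ ((P₁ ∘ᴾ P₂) ·ᴾ Q)) (forgetᴾ (P₂ ·ᴾ (reverseᴾ P₁ ∘ᴾ Q))) moveˡ adj-moveˡ
    where
      P₁ : LPresentation F₁
      P₁ = canonicalᴾ F₁
      P₂ : LPresentation F₂
      P₂ = canonicalᴾ F₂
      Q  : LPresentation W
      Q  = canonicalᴾ W
      module P₁ = LPresentation P₁
      module P₂ = LPresentation P₂
      module Q  = LPresentation Q
      open ≡-Reasoning
      adj-moveˡ : ∀ s t → LPresentation.adj (P₂ ·ᴾ (reverseᴾ P₁ ∘ᴾ Q)) (moveˡ-to s) (moveˡ-to t)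
                        ≡ LPresentation.adj ((P₁ ∘ᴾ P₂) ·ᴾ Q) s t
      adj-moveˡ s t = begin
        _ ≡⟨ cong₂ _+_ (⟨⟩-cong P₂.adj (proj₁ ∘ moveˡ-pieces) s t)
                       (trans (⟨⟩-+ᴬ-⟨⟩ (P₁.adj ⟨ swapLabelsᴹ ⟩) segment₁ Q.adj segment₂ factor₂ s′ t′)
                              (cong₂ _+_ (trans (⟨⟩-⟨⟩ P₁.adj swapLabelsᴹ (factor₂ >=> segment₁) s′ t′)
                                                (⟨⟩-cong P₁.adj (proj₁ ∘ proj₂ ∘ moveˡ-pieces) s t))
                                         (⟨⟩-cong Q.adj (proj₂ ∘ proj₂ ∘ moveˡ-pieces) s t))) ⟩
        a₂ + (a₁ + b) ≡⟨ x∙yz≈yx∙z a₂ a₁ b ⟩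
        (a₁ + a₂) + b ≡⟨ cong (_+ b) (⟨⟩-+ᴬ-⟨⟩ P₁.adj segment₁ P₂.adj segment₂ factor₁ s t) ⟨
        _ ∎
        where
          s′ t′ : Fin 2 ⊎ (P₂.Unlabeled ⊎ (Fin 1 ⊎ (P₁.Unlabeled ⊎ Q.Unlabeled)))
          s′ = moveˡ-to s
          t′ = moveˡ-to t
          a₁ a₂ b : ℕ
          a₁ = (P₁.adj ⟨ factor₁ >=> segment₁ ⟩) s t
          a₂ = (P₂.adj ⟨ factor₁ >=> segment₂ ⟩) s t
          b  = (Q.adj ⟨ factor₂ ⟩) s t

  ·ᴳ-comm : ∀ {k} (F G : LGraph k) → forget (F ·ᴳ G) ≅ forget (G ·ᴳ F)
  ·ᴳ-comm {k} F G = ≅-via (forgetᴾ (P ·ᴾ Q)) (forgetᴾ (Q ·ᴾ P)) ρ adj-comm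
    where
      P : LPresentation F
      P = canonicalᴾ F
      Q : LPresentation G
      Q = canonicalᴾ G
      module P = LPresentation P
      module Q = LPresentation Q
      ρ : (Fin k ⊎ (P.Unlabeled ⊎ Q.Unlabeled)) ↔ (Fin k ⊎ (Q.Unlabeled ⊎ P.Unlabeled))
      ρ = ↔-refl ⊎-↔ ⊎-comm P.Unlabeled Q.Unlabeled
      swap-pieces : ∀ s → factor₁ (to ρ s) ≡ factor₂ s × factor₂ (to ρ s) ≡ factor₁ s
      swap-pieces (inj₁ i)        = refl , refl
      swap-pieces (inj₂ (inj₁ a)) = refl , refl
      swap-pieces (inj₂ (inj₂ b)) = refl , refl
      adj-comm : ∀ s t → LPresentation.adj (Q ·ᴾ P) (to ρ s) (to ρ t) ≡ LPresentation.adj (P ·ᴾ Q) s t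
      adj-comm s t = trans (cong₂ _+_ (⟨⟩-cong Q.adj (proj₁ ∘ swap-pieces) s t)
                                      (⟨⟩-cong P.adj (proj₂ ∘ swap-pieces) s t))
                           (+-comm ((Q.adj ⟨ factor₂ ⟩) s t) ((P.adj ⟨ factor₁ ⟩) s t))

  module _ {U₁ U₂ U₃ V : Set} where

    private
      S T : Set
      S = Fin 2 ⊎ ((Fin 1 ⊎ ((Fin 1 ⊎ (U₁ ⊎ U₂)) ⊎ U₃)) ⊎ V)
      T = Fin 2 ⊎ ((Fin 1 ⊎ (U₁ ⊎ (Fin 1 ⊎ (U₂ ⊎ U₃)))) ⊎ V)

    reassoc-to : S → T
    reassoc-to (inj₁ i)                                     = inj₁ i
    reassoc-to (inj₂ (inj₁ (inj₁ zero)))                    = inj₂ (inj₁ (inj₂ (inj₂ (inj₁ zero))))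
    reassoc-to (inj₂ (inj₁ (inj₂ (inj₁ (inj₁ zero)))))      = inj₂ (inj₁ (inj₁ zero))
    reassoc-to (inj₂ (inj₁ (inj₂ (inj₁ (inj₂ (inj₁ a))))))  = inj₂ (inj₁ (inj₂ (inj₁ a)))
    reassoc-to (inj₂ (inj₁ (inj₂ (inj₁ (inj₂ (inj₂ b))))))  = inj₂ (inj₁ (inj₂ (inj₂ (inj₂ (inj₁ b)))))
    reassoc-to (inj₂ (inj₁ (inj₂ (inj₂ c))))                = inj₂ (inj₁ (inj₂ (inj₂ (inj₂ (inj₂ c)))))
    reassoc-to (inj₂ (inj₂ w))                              = inj₂ (inj₂ w)

    reassoc-from : T → S
    reassoc-from (inj₁ i)                                   = inj₁ i
    reassoc-from (inj₂ (inj₁ (inj₂ (inj₂ (inj₁ zero)))))    = inj₂ (inj₁ (inj₁ zero))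
    reassoc-from (inj₂ (inj₁ (inj₁ zero)))                  = inj₂ (inj₁ (inj₂ (inj₁ (inj₁ zero))))
    reassoc-from (inj₂ (inj₁ (inj₂ (inj₁ a))))              = inj₂ (inj₁ (inj₂ (inj₁ (inj₂ (inj₁ a)))))
    reassoc-from (inj₂ (inj₁ (inj₂ (inj₂ (inj₂ (inj₁ b)))))) = inj₂ (inj₁ (inj₂ (inj₁ (inj₂ (inj₂ b)))))
    reassoc-from (inj₂ (inj₁ (inj₂ (inj₂ (inj₂ (inj₂ c)))))) = inj₂ (inj₁ (inj₂ (inj₂ c)))
    reassoc-from (inj₂ (inj₂ w))                            = inj₂ (inj₂ w)

    reassoc : S ↔ T
    reassoc = mk↔ₛ′ reassoc-to reassoc-from to∘from from∘to
      where
        to∘from : ∀ t → reassoc-to (reassoc-from t) ≡ t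
        to∘from (inj₁ i)                                     = refl
        to∘from (inj₂ (inj₁ (inj₂ (inj₂ (inj₁ zero)))))      = refl
        to∘from (inj₂ (inj₁ (inj₁ zero)))                    = refl
        to∘from (inj₂ (inj₁ (inj₂ (inj₁ a))))                = refl
        to∘from (inj₂ (inj₁ (inj₂ (inj₂ (inj₂ (inj₁ b))))))  = refl
        to∘from (inj₂ (inj₁ (inj₂ (inj₂ (inj₂ (inj₂ c))))))  = refl
        to∘from (inj₂ (inj₂ w))                              = refl
        from∘to : ∀ s → reassoc-from (reassoc-to s) ≡ s
        from∘to (inj₁ i)                                     = refl
        from∘to (inj₂ (inj₁ (inj₁ zero)))                    = refl
        from∘to (inj₂ (inj₁ (inj₂ (inj₁ (inj₁ zero)))))      = refl
        from∘to (inj₂ (inj₁ (inj₂ (inj₁ (inj₂ (inj₁ a))))))  = refl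
        from∘to (inj₂ (inj₁ (inj₂ (inj₁ (inj₂ (inj₂ b))))))  = refl
        from∘to (inj₂ (inj₁ (inj₂ (inj₂ c))))                = refl
        from∘to (inj₂ (inj₂ w))                              = refl

    reassoc-pieces : ∀ s → (factor₁ >=> segment₁) (reassoc-to s) ≡ ((factor₁ >=> segment₁) >=> segment₁) s
                         × ((factor₁ >=> segment₂) >=> segment₁) (reassoc-to s) ≡ ((factor₁ >=> segment₁) >=> segment₂) s
                         × ((factor₁ >=> segment₂) >=> segment₂) (reassoc-to s) ≡ (factor₁ >=> segment₂) s
                         × factor₂ (reassoc-to s) ≡ factor₂ s
    reassoc-pieces (inj₁ zero)                                    = refl , refl , refl , refl
    reassoc-pieces (inj₁ (suc zero))                              = refl , refl , refl , refl
    reassoc-pieces (inj₂ (inj₁ (inj₁ zero)))                      = refl , refl , refl , refl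
    reassoc-pieces (inj₂ (inj₁ (inj₂ (inj₁ (inj₁ zero)))))        = refl , refl , refl , refl
    reassoc-pieces (inj₂ (inj₁ (inj₂ (inj₁ (inj₂ (inj₁ a))))))    = refl , refl , refl , refl
    reassoc-pieces (inj₂ (inj₁ (inj₂ (inj₁ (inj₂ (inj₂ b))))))    = refl , refl , refl , refl
    reassoc-pieces (inj₂ (inj₁ (inj₂ (inj₂ c))))                  = refl , refl , refl , refl
    reassoc-pieces (inj₂ (inj₂ w))                                = refl , refl , refl , refl

  ∘ᴳ-assoc-·ᴳ : ∀ F₁ F₂ F₃ W →
                forget (((F₁ ∘ᴳ F₂) ∘ᴳ F₃) ·ᴳ W) ≅ forget ((F₁ ∘ᴳ (F₂ ∘ᴳ F₃)) ·ᴳ W)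
  ∘ᴳ-assoc-·ᴳ F₁ F₂ F₃ W =
    ≅-via (forgetᴾ (((P₁ ∘ᴾ P₂) ∘ᴾ P₃) ·ᴾ Q)) (forgetᴾ ((P₁ ∘ᴾ (P₂ ∘ᴾ P₃)) ·ᴾ Q)) reassoc adj-reassoc
    where
      P₁ : LPresentation F₁
      P₁ = canonicalᴾ F₁
      P₂ : LPresentation F₂
      P₂ = canonicalᴾ F₂
      P₃ : LPresentation F₃
      P₃ = canonicalᴾ F₃
      Q  : LPresentation W
      Q  = canonicalᴾ W
      module P₁ = LPresentation P₁
      module P₂ = LPresentation P₂
      module P₃ = LPresentation P₃
      module Q  = LPresentation Q
      A₁₂ : Adj (Fin 2 ⊎ LPresentation.Unlabeled (P₁ ∘ᴾ P₂))
      A₁₂ = LPresentation.adj (P₁ ∘ᴾ P₂)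
      A₂₃ : Adj (Fin 2 ⊎ LPresentation.Unlabeled (P₂ ∘ᴾ P₃))
      A₂₃ = LPresentation.adj (P₂ ∘ᴾ P₃)
      open ≡-Reasoning
      adj-reassoc : ∀ s t → LPresentation.adj ((P₁ ∘ᴾ (P₂ ∘ᴾ P₃)) ·ᴾ Q) (reassoc-to s) (reassoc-to t)
                          ≡ LPresentation.adj (((P₁ ∘ᴾ P₂) ∘ᴾ P₃) ·ᴾ Q) s t
      adj-reassoc s t = begin
        _ ≡⟨ cong (_+ (Q.adj ⟨ factor₂ ⟩) s′ t′)
                  (trans (⟨⟩-+ᴬ-⟨⟩ P₁.adj segment₁ A₂₃ segment₂ factor₁ s′ t′)
                         (cong ((P₁.adj ⟨ factor₁ >=> segment₁ ⟩) s′ t′ +_)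
                               (⟨⟩-+ᴬ-⟨⟩ P₂.adj segment₁ P₃.adj segment₂ (factor₁ >=> segment₂) s′ t′))) ⟩
        _ ≡⟨ cong₂ _+_ (cong₂ _+_ (⟨⟩-cong P₁.adj (proj₁ ∘ reassoc-pieces) s t)
                                  (cong₂ _+_ (⟨⟩-cong P₂.adj (proj₁ ∘ proj₂ ∘ reassoc-pieces) s t)
                                             (⟨⟩-cong P₃.adj (proj₁ ∘ proj₂ ∘ proj₂ ∘ reassoc-pieces) s t)))
                       (⟨⟩-cong Q.adj (proj₂ ∘ proj₂ ∘ proj₂ ∘ reassoc-pieces) s t) ⟩
        (a₁ + (a₂ + a₃)) + b ≡⟨ cong (_+ b) (+-assoc a₁ a₂ a₃) ⟨
        ((a₁ + a₂) + a₃) + b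
          ≡⟨ cong (_+ b) (trans (⟨⟩-+ᴬ-⟨⟩ A₁₂ segment₁ P₃.adj segment₂ factor₁ s t)
                                (cong (_+ a₃) (⟨⟩-+ᴬ-⟨⟩ P₁.adj segment₁ P₂.adj segment₂ (factor₁ >=> segment₁) s t))) ⟨
        _ ∎
        where
          s′ t′ : Fin 2 ⊎ ((Fin 1 ⊎ (P₁.Unlabeled ⊎ (Fin 1 ⊎ (P₂.Unlabeled ⊎ P₃.Unlabeled)))) ⊎ Q.Unlabeled)
          s′ = reassoc-to s
          t′ = reassoc-to t
          a₁ a₂ a₃ b : ℕ
          a₁ = (P₁.adj ⟨ (factor₁ >=> segment₁) >=> segment₁ ⟩) s t
          a₂ = (P₂.adj ⟨ (factor₁ >=> segment₁) >=> segment₂ ⟩) s t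
          a₃ = (P₃.adj ⟨ factor₁ >=> segment₂ ⟩) s t
          b  = (Q.adj ⟨ factor₂ ⟩) s t

  module _ {U V : Set} where

    private
      S T : Set
      S = Fin 1 ⊎ (Fin 1 ⊎ (V ⊎ U))
      T = Fin 2 ⊎ (U ⊎ V)

    unfoldʳ-to : S → T
    unfoldʳ-to (inj₁ zero)                = inj₁ zero
    unfoldʳ-to (inj₂ (inj₁ zero))         = inj₁ (suc zero)
    unfoldʳ-to (inj₂ (inj₂ (inj₁ w)))     = inj₂ (inj₂ w)
    unfoldʳ-to (inj₂ (inj₂ (inj₂ a)))     = inj₂ (inj₁ a)

    unfoldʳ-from : T → S
    unfoldʳ-from (inj₁ zero)              = inj₁ zero
    unfoldʳ-from (inj₁ (suc zero))        = inj₂ (inj₁ zero)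
    unfoldʳ-from (inj₂ (inj₂ w))          = inj₂ (inj₂ (inj₁ w))
    unfoldʳ-from (inj₂ (inj₁ a))          = inj₂ (inj₂ (inj₂ a))

    unfoldʳ : S ↔ T
    unfoldʳ = mk↔ₛ′ unfoldʳ-to unfoldʳ-from to∘from from∘to
      where
        to∘from : ∀ t → unfoldʳ-to (unfoldʳ-from t) ≡ t
        to∘from (inj₁ zero)            = refl
        to∘from (inj₁ (suc zero))      = refl
        to∘from (inj₂ (inj₂ w))        = refl
        to∘from (inj₂ (inj₁ a))        = refl
        from∘to : ∀ s → unfoldʳ-from (unfoldʳ-to s) ≡ s
        from∘to (inj₁ zero)            = refl
        from∘to (inj₂ (inj₁ zero))     = refl
        from∘to (inj₂ (inj₂ (inj₁ w))) = refl
        from∘to (inj₂ (inj₂ (inj₂ a))) = refl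

    unfoldʳ-pieces : ∀ s → factor₁ (unfoldʳ-to s) ≡ (merged₂ >=> swapLabelsᴹ) s
                         × factor₂ (unfoldʳ-to s) ≡ merged₁ s
    unfoldʳ-pieces (inj₁ zero)            = refl , refl
    unfoldʳ-pieces (inj₂ (inj₁ zero))     = refl , refl
    unfoldʳ-pieces (inj₂ (inj₂ (inj₁ w))) = refl , refl
    unfoldʳ-pieces (inj₂ (inj₂ (inj₂ a))) = refl , refl

  contract-∘ᴳ-reverseᴳ : ∀ W F →
                         forget (contract (W ∘ᴳ reverseᴳ F) (∘ᴳ-nonadj W (reverseᴳ F))) ≅ forget (F ·ᴳ W)
  contract-∘ᴳ-reverseᴳ W F =
    ≅-via (forgetᴾ (contract-∘ᴾ Q (reverseᴾ P))) (forgetᴾ (P ·ᴾ Q)) unfoldʳ adj-unfoldʳ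
    where
      P : LPresentation F
      P = canonicalᴾ F
      Q : LPresentation W
      Q = canonicalᴾ W
      module P = LPresentation P
      module Q = LPresentation Q
      adj-unfoldʳ : ∀ s t → LPresentation.adj (P ·ᴾ Q) (unfoldʳ-to s) (unfoldʳ-to t)
                          ≡ LPresentation.adj (contract-∘ᴾ Q (reverseᴾ P)) s t
      adj-unfoldʳ s t =
        trans (cong₂ _+_ (⟨⟩-cong P.adj (proj₁ ∘ unfoldʳ-pieces) s t)
                         (⟨⟩-cong Q.adj (proj₂ ∘ unfoldʳ-pieces) s t))
        (trans (+-comm ((P.adj ⟨ merged₂ >=> swapLabelsᴹ ⟩) s t) ((Q.adj ⟨ merged₁ ⟩) s t))
               (cong ((Q.adj ⟨ merged₁ ⟩) s t +_) (sym (⟨⟩-⟨⟩ P.adj swapLabelsᴹ merged₂ s t))))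

  module _ {U V : Set} where

    private
      S T : Set
      S = Fin 1 ⊎ (Fin 1 ⊎ (U ⊎ V))
      T = Fin 2 ⊎ (U ⊎ V)

    unfoldˡ-to : S → T
    unfoldˡ-to (inj₁ zero)        = inj₁ (suc zero)
    unfoldˡ-to (inj₂ (inj₁ zero)) = inj₁ zero
    unfoldˡ-to (inj₂ (inj₂ x))    = inj₂ x

    unfoldˡ-from : T → S
    unfoldˡ-from (inj₁ (suc zero)) = inj₁ zero
    unfoldˡ-from (inj₁ zero)       = inj₂ (inj₁ zero)
    unfoldˡ-from (inj₂ x)          = inj₂ (inj₂ x)

    unfoldˡ : S ↔ T
    unfoldˡ = mk↔ₛ′ unfoldˡ-to unfoldˡ-from to∘from from∘to
      where
        to∘from : ∀ t → unfoldˡ-to (unfoldˡ-from t) ≡ t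
        to∘from (inj₁ (suc zero))  = refl
        to∘from (inj₁ zero)        = refl
        to∘from (inj₂ x)           = refl
        from∘to : ∀ s → unfoldˡ-from (unfoldˡ-to s) ≡ s
        from∘to (inj₁ zero)        = refl
        from∘to (inj₂ (inj₁ zero)) = refl
        from∘to (inj₂ (inj₂ x))    = refl

    unfoldˡ-pieces : ∀ s → factor₁ (unfoldˡ-to s) ≡ (merged₁ >=> swapLabelsᴹ) s
                         × factor₂ (unfoldˡ-to s) ≡ merged₂ s
    unfoldˡ-pieces (inj₁ zero)            = refl , refl
    unfoldˡ-pieces (inj₂ (inj₁ zero))     = refl , refl
    unfoldˡ-pieces (inj₂ (inj₂ (inj₁ a))) = refl , refl
    unfoldˡ-pieces (inj₂ (inj₂ (inj₂ w))) = refl , refl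

  contract-reverseᴳ-∘ᴳ : ∀ F W →
                         forget (contract (reverseᴳ F ∘ᴳ W) (∘ᴳ-nonadj (reverseᴳ F) W)) ≅ forget (F ·ᴳ W)
  contract-reverseᴳ-∘ᴳ F W =
    ≅-via (forgetᴾ (contract-∘ᴾ (reverseᴾ P) Q)) (forgetᴾ (P ·ᴾ Q)) unfoldˡ adj-unfoldˡ
    where
      P : LPresentation F
      P = canonicalᴾ F
      Q : LPresentation W
      Q = canonicalᴾ W
      module P = LPresentation P
      module Q = LPresentation Q
      adj-unfoldˡ : ∀ s t → LPresentation.adj (P ·ᴾ Q) (unfoldˡ-to s) (unfoldˡ-to t)
                          ≡ LPresentation.adj (contract-∘ᴾ (reverseᴾ P) Q) s t
      adj-unfoldˡ s t =
        trans (cong₂ _+_ (⟨⟩-cong P.adj (proj₁ ∘ unfoldˡ-pieces) s t)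
                         (⟨⟩-cong Q.adj (proj₂ ∘ unfoldˡ-pieces) s t))
              (cong (_+ (Q.adj ⟨ merged₂ ⟩) s t) (sym (⟨⟩-⟨⟩ P.adj swapLabelsᴹ merged₁ s t)))

module QuantumAlgebra {c ℓ} (R : CommutativeRing c ℓ) (f : GraphParameter R) where

  open import Level using (_⊔_)
  open import Data.Product using (proj₁; proj₂)
  open import Data.List using (List; []; _∷_; _++_; map; concatMap)
  open import Data.List.Properties using (concatMap-++; map-concatMap; concatMap-cong; map-∘)
  open import Relation.Binary.PropositionalEquality as ≡ using (_≡_)
  open import Algebra.Properties.Ring (CommutativeRing.ring R)
    using (-‿distribˡ-*; -0#≈0#; -‿+-comm; x∙y⁻¹≈ε⇒x≈y; x≈y⇒x∙y⁻¹≈ε)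
  open import Algebra.Properties.CommutativeSemigroup (CommutativeRing.+-commutativeSemigroup R)
    using (interchange)
  open import Algebra.Properties.CommutativeSemigroup (CommutativeRing.*-commutativeSemigroup R)
    using (xy∙z≈x∙zy; xy∙z≈y∙xz; x∙yz≈y∙xz)
  open CommutativeRing R renaming (Carrier to K)
  open import Relation.Binary.Reasoning.Setoid setoid
  open GraphIsomorphisms

  φ : Graph → K
  φ = proj₁ f

  φ-iso : ∀ {G H} → G ≅ H → φ G ≈ φ H
  φ-iso {G} {H} = proj₂ f G H

  ∑ : ∀ {A : Set c} → List A → (A → K) → K
  ∑ []       g = 0#
  ∑ (a ∷ xs) g = g a + ∑ xs g

  syntax ∑ xs (λ x → e) = ∑[ x ∈ xs ] e

  module _ {A : Set c} where

    ∑-cong : (xs : List A) {g h : A → K} → (∀ a → g a ≈ h a) → ∑ xs g ≈ ∑ xs h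
    ∑-cong []       g≈h = refl
    ∑-cong (a ∷ xs) g≈h = +-cong (g≈h a) (∑-cong xs g≈h)

    ∑-++ : (xs ys : List A) (g : A → K) → ∑ (xs ++ ys) g ≈ ∑ xs g + ∑ ys g
    ∑-++ []       ys g = sym (+-identityˡ _)
    ∑-++ (a ∷ xs) ys g = trans (+-congˡ (∑-++ xs ys g)) (sym (+-assoc _ _ _))

    ∑-+ : (xs : List A) (g h : A → K) → ∑[ a ∈ xs ] (g a + h a) ≈ ∑ xs g + ∑ xs h
    ∑-+ []       g h = sym (+-identityˡ _)
    ∑-+ (a ∷ xs) g h = trans (+-congˡ (∑-+ xs g h)) (interchange (g a) (h a) (∑ xs g) (∑ xs h))

    ∑-0 : (xs : List A) → ∑[ a ∈ xs ] 0# ≈ 0#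
    ∑-0 []       = refl
    ∑-0 (a ∷ xs) = trans (+-identityˡ _) (∑-0 xs)

    ∑-neg : (xs : List A) (g : A → K) → ∑[ a ∈ xs ] (- g a) ≈ - ∑ xs g
    ∑-neg []       g = sym -0#≈0#
    ∑-neg (a ∷ xs) g = trans (+-congˡ (∑-neg xs g)) (-‿+-comm (g a) (∑ xs g))

  ∑-map : ∀ {A B : Set c} (h : A → B) (xs : List A) (g : B → K) → ∑ (map h xs) g ≈ ∑[ a ∈ xs ] g (h a)
  ∑-map h []       g = refl
  ∑-map h (a ∷ xs) g = +-congˡ (∑-map h xs g)

  ∑-concatMap : ∀ {A B : Set c} (h : A → List B) (xs : List A) (g : B → K) →
                ∑ (concatMap h xs) g ≈ ∑[ a ∈ xs ] ∑ (h a) g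
  ∑-concatMap h []       g = refl
  ∑-concatMap h (a ∷ xs) g = trans (∑-++ (h a) (concatMap h xs) g) (+-congˡ (∑-concatMap h xs g))

  ∑-pairs : ∀ {A B C : Set c} (h : A → B → C) (xs : List A) (ys : List B) (g : C → K) →
            ∑ (concatMap (λ a → map (h a) ys) xs) g ≈ ∑[ a ∈ xs ] ∑[ b ∈ ys ] g (h a b)
  ∑-pairs h xs ys g = trans (∑-concatMap _ xs g) (∑-cong xs (λ a → ∑-map (h a) ys g))

  ∑-comm : ∀ {A B : Set c} (xs : List A) (ys : List B) (g : A → B → K) →
           ∑[ a ∈ xs ] ∑[ b ∈ ys ] g a b ≈ ∑[ b ∈ ys ] ∑[ a ∈ xs ] g a b
  ∑-comm []       ys g = sym (∑-0 ys)
  ∑-comm (a ∷ xs) ys g = trans (+-congˡ (∑-comm xs ys g)) (sym (∑-+ ys (g a) (λ b → ∑[ a ∈ xs ] g a b)))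

  -- The pairing ⟪ x , w ⟫ = f (x w)

  infixl 7 _∘q_ _·q_
  infixl 6 _⊕q_

  _∘q_ _·q_ _⊕q_ : QG R 2 → QG R 2 → QG R 2
  _∘q_ = _∘Q_ R
  _·q_ = _·Q_ R
  _⊕q_ = _⊕_ R

  _⊙q_ : K → QG R 2 → QG R 2
  _⊙q_ = _⊙_ R

  ⊖q_ : QG R 2 → QG R 2
  ⊖q_ = ⊖_ R

  infix 4 _≡ₘ_
  _≡ₘ_ : QG R 2 → QG R 2 → Set (c ⊔ ℓ)
  _≡ₘ_ = EqMod R f

  Term : Set c
  Term = K × LGraph 2

  _∘ₜ_ : Term → Term → Term
  s ∘ₜ t = proj₁ s * proj₁ t , proj₂ s ∘ᴳ proj₂ t

  reverseₜ : Term → Term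
  reverseₜ t = proj₁ t , reverseᴳ (proj₂ t)

  reverseQ : QG R 2 → QG R 2
  reverseQ = map reverseₜ

  ⟨_∣_⟩ : Term → Term → K
  ⟨ s ∣ r ⟩ = (proj₁ s * proj₁ r) * φ (forget (proj₂ s ·ᴳ proj₂ r))

  ⟪_,_⟫ : QG R 2 → QG R 2 → K
  ⟪ x , w ⟫ = ∑[ s ∈ x ] ∑[ r ∈ w ] ⟨ s ∣ r ⟩

  evalQ-∑ : ∀ {k} (x : QG R k) → evalQ R f x ≈ ∑[ t ∈ x ] (proj₁ t * φ (forget (proj₂ t)))
  evalQ-∑ []            = refl
  evalQ-∑ ((a , F) ∷ x) = +-congˡ (evalQ-∑ x)

  evalQ-·q : ∀ x w → evalQ R f (x ·q w) ≈ ⟪ x , w ⟫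
  evalQ-·q x w = trans (evalQ-∑ (x ·q w)) (∑-pairs _ x w _)

  ⟪⊕q⟫ : ∀ x y w → ⟪ x ⊕q y , w ⟫ ≈ ⟪ x , w ⟫ + ⟪ y , w ⟫
  ⟪⊕q⟫ x y w = ∑-++ x y _

  ⟪⊖q⟫ : ∀ y w → ⟪ ⊖q y , w ⟫ ≈ - ⟪ y , w ⟫
  ⟪⊖q⟫ y w = begin
    ⟪ ⊖q y , w ⟫                                        ≈⟨ ∑-map _ y _ ⟩
    ∑[ s ∈ y ] ∑[ r ∈ w ] ⟨ (- proj₁ s , proj₂ s) ∣ r ⟩ ≈⟨ ∑-cong y (λ s → ∑-cong w (neg-term s)) ⟩
    ∑[ s ∈ y ] ∑[ r ∈ w ] (- ⟨ s ∣ r ⟩)                 ≈⟨ ∑-cong y (λ s → ∑-neg w _) ⟩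
    ∑[ s ∈ y ] (- ∑[ r ∈ w ] ⟨ s ∣ r ⟩)                 ≈⟨ ∑-neg y _ ⟩
    - ⟪ y , w ⟫                                         ∎
    where
      neg-term : ∀ s r → ⟨ (- proj₁ s , proj₂ s) ∣ r ⟩ ≈ - ⟨ s ∣ r ⟩
      neg-term s r = trans (*-congʳ (sym (-‿distribˡ-* _ _))) (sym (-‿distribˡ-* _ _))

  ⟪⟫-difference : ∀ x y w → evalQ R f ((x ⊕q ⊖q y) ·q w) ≈ ⟪ x , w ⟫ - ⟪ y , w ⟫
  ⟪⟫-difference x y w = trans (evalQ-·q (x ⊕q ⊖q y) w) (trans (⟪⊕q⟫ x (⊖q y) w) (+-congˡ (⟪⊖q⟫ y w)))

  ≈⟪⟫⇒≡ₘ : ∀ x y → (∀ w → ⟪ x , w ⟫ ≈ ⟪ y , w ⟫) → x ≡ₘ y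
  ≈⟪⟫⇒≡ₘ x y x≈y w = trans (⟪⟫-difference x y w) (x≈y⇒x∙y⁻¹≈ε (x≈y w))

  ≡ₘ⇒≈⟪⟫ : ∀ x y → x ≡ₘ y → ∀ w → ⟪ x , w ⟫ ≈ ⟪ y , w ⟫
  ≡ₘ⇒≈⟪⟫ x y x≡y w = x∙y⁻¹≈ε⇒x≈y _ _ (trans (sym (⟪⟫-difference x y w)) (x≡y w))

  ⟨∣⟩-coeff-cong : ∀ {a b} F r → a ≈ b → ⟨ (a , F) ∣ r ⟩ ≈ ⟨ (b , F) ∣ r ⟩
  ⟨∣⟩-coeff-cong F r a≈b = *-congʳ (*-congʳ a≈b)

  ⟨∣⟩-comm : ∀ s r → ⟨ s ∣ r ⟩ ≈ ⟨ r ∣ s ⟩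
  ⟨∣⟩-comm (a , F) (b , G) = *-cong (*-comm a b) (φ-iso (·ᴳ-comm F G))

  ⟨∘ₜ∣⟩-moveʳ : ∀ s t r → ⟨ s ∘ₜ t ∣ r ⟩ ≈ ⟨ s ∣ r ∘ₜ reverseₜ t ⟩
  ⟨∘ₜ∣⟩-moveʳ (a , F₁) (b , F₂) (c , W) = *-cong (xy∙z≈x∙zy a b c) (φ-iso (∘ᴳ-·ᴳ-moveʳ F₁ F₂ W))

  ⟨∘ₜ∣⟩-moveˡ : ∀ s t r → ⟨ s ∘ₜ t ∣ r ⟩ ≈ ⟨ t ∣ reverseₜ s ∘ₜ r ⟩
  ⟨∘ₜ∣⟩-moveˡ (a , F₁) (b , F₂) (c , W) = *-cong (xy∙z≈y∙xz a b c) (φ-iso (∘ᴳ-·ᴳ-moveˡ F₁ F₂ W))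

  ⟨∘ₜ∣⟩-assoc : ∀ s t u r → ⟨ (s ∘ₜ t) ∘ₜ u ∣ r ⟩ ≈ ⟨ s ∘ₜ (t ∘ₜ u) ∣ r ⟩
  ⟨∘ₜ∣⟩-assoc (a , F₁) (b , F₂) (c , F₃) (d , W) =
    *-cong (*-congʳ (*-assoc a b c)) (φ-iso (∘ᴳ-assoc-·ᴳ F₁ F₂ F₃ W))

  ∑-∘q : ∀ x y (g : Term → K) → ∑ (x ∘q y) g ≈ ∑[ s ∈ x ] ∑[ t ∈ y ] g (s ∘ₜ t)
  ∑-∘q x y g = ∑-pairs _∘ₜ_ x y g

  ∑-reverseQ : ∀ x (g : Term → K) → ∑ (reverseQ x) g ≈ ∑[ t ∈ x ] g (reverseₜ t)
  ∑-reverseQ x g = ∑-map reverseₜ x g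

  ⟪⟫-comm : ∀ x w → ⟪ x , w ⟫ ≈ ⟪ w , x ⟫
  ⟪⟫-comm x w = trans (∑-comm x w ⟨_∣_⟩) (∑-cong w λ r → ∑-cong x λ s → ⟨∣⟩-comm s r)

  ⟪∘q⟫-moveʳ : ∀ x y w → ⟪ x ∘q y , w ⟫ ≈ ⟪ x , w ∘q reverseQ y ⟫
  ⟪∘q⟫-moveʳ x y w = begin
    ⟪ x ∘q y , w ⟫
      ≈⟨ ∑-∘q x y _ ⟩
    ∑[ s ∈ x ] ∑[ t ∈ y ] ∑[ r ∈ w ] ⟨ s ∘ₜ t ∣ r ⟩
      ≈⟨ ∑-cong x (λ s → ∑-comm y w _) ⟩
    ∑[ s ∈ x ] ∑[ r ∈ w ] ∑[ t ∈ y ] ⟨ s ∘ₜ t ∣ r ⟩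
      ≈⟨ ∑-cong x (λ s → ∑-cong w λ r → ∑-cong y λ t → ⟨∘ₜ∣⟩-moveʳ s t r) ⟩
    ∑[ s ∈ x ] ∑[ r ∈ w ] ∑[ t ∈ y ] ⟨ s ∣ r ∘ₜ reverseₜ t ⟩
      ≈⟨ ∑-cong x (λ s → ∑-cong w λ r → ∑-reverseQ y _) ⟨
    ∑[ s ∈ x ] ∑[ r ∈ w ] ∑[ t ∈ reverseQ y ] ⟨ s ∣ r ∘ₜ t ⟩
      ≈⟨ ∑-cong x (λ s → ∑-∘q w (reverseQ y) _) ⟨
    ⟪ x , w ∘q reverseQ y ⟫ ∎

  ⟪∘q⟫-moveˡ : ∀ x y w → ⟪ x ∘q y , w ⟫ ≈ ⟪ y , reverseQ x ∘q w ⟫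
  ⟪∘q⟫-moveˡ x y w = begin
    ⟪ x ∘q y , w ⟫
      ≈⟨ ∑-∘q x y _ ⟩
    ∑[ s ∈ x ] ∑[ t ∈ y ] ∑[ r ∈ w ] ⟨ s ∘ₜ t ∣ r ⟩
      ≈⟨ ∑-comm x y _ ⟩
    ∑[ t ∈ y ] ∑[ s ∈ x ] ∑[ r ∈ w ] ⟨ s ∘ₜ t ∣ r ⟩
      ≈⟨ ∑-cong y (λ t → ∑-cong x λ s → ∑-cong w λ r → ⟨∘ₜ∣⟩-moveˡ s t r) ⟩
    ∑[ t ∈ y ] ∑[ s ∈ x ] ∑[ r ∈ w ] ⟨ t ∣ reverseₜ s ∘ₜ r ⟩
      ≈⟨ ∑-cong y (λ t → ∑-reverseQ x _) ⟨
    ∑[ t ∈ y ] ∑[ s ∈ reverseQ x ] ∑[ r ∈ w ] ⟨ t ∣ s ∘ₜ r ⟩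
      ≈⟨ ∑-cong y (λ t → ∑-∘q (reverseQ x) w _) ⟨
    ⟪ y , reverseQ x ∘q w ⟫ ∎

  -- The algebra G₂/f

  ∘q-cong : ∀ x x′ y y′ → x ≡ₘ x′ → y ≡ₘ y′ → x ∘q y ≡ₘ x′ ∘q y′
  ∘q-cong x x′ y y′ x≡x′ y≡y′ = ≈⟪⟫⇒≡ₘ (x ∘q y) (x′ ∘q y′) λ w → begin
    ⟪ x ∘q y , w ⟫              ≈⟨ ⟪∘q⟫-moveʳ x y w ⟩
    ⟪ x , w ∘q reverseQ y ⟫     ≈⟨ ≡ₘ⇒≈⟪⟫ x x′ x≡x′ (w ∘q reverseQ y) ⟩
    ⟪ x′ , w ∘q reverseQ y ⟫    ≈⟨ ⟪∘q⟫-moveʳ x′ y w ⟨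
    ⟪ x′ ∘q y , w ⟫             ≈⟨ ⟪∘q⟫-moveˡ x′ y w ⟩
    ⟪ y , reverseQ x′ ∘q w ⟫    ≈⟨ ≡ₘ⇒≈⟪⟫ y y′ y≡y′ (reverseQ x′ ∘q w) ⟩
    ⟪ y′ , reverseQ x′ ∘q w ⟫   ≈⟨ ⟪∘q⟫-moveˡ x′ y′ w ⟨
    ⟪ x′ ∘q y′ , w ⟫            ∎

  ∘q-assoc : ∀ x y v → (x ∘q y) ∘q v ≡ₘ x ∘q (y ∘q v)
  ∘q-assoc x y v = ≈⟪⟫⇒≡ₘ ((x ∘q y) ∘q v) (x ∘q (y ∘q v)) λ w → begin
    ⟪ (x ∘q y) ∘q v , w ⟫
      ≈⟨ ∑-∘q (x ∘q y) v _ ⟩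
    ∑[ st ∈ x ∘q y ] ∑[ u ∈ v ] ∑[ r ∈ w ] ⟨ st ∘ₜ u ∣ r ⟩
      ≈⟨ ∑-∘q x y _ ⟩
    ∑[ s ∈ x ] ∑[ t ∈ y ] ∑[ u ∈ v ] ∑[ r ∈ w ] ⟨ (s ∘ₜ t) ∘ₜ u ∣ r ⟩
      ≈⟨ ∑-cong x (λ s → ∑-cong y λ t → ∑-cong v λ u → ∑-cong w λ r → ⟨∘ₜ∣⟩-assoc s t u r) ⟩
    ∑[ s ∈ x ] ∑[ t ∈ y ] ∑[ u ∈ v ] ∑[ r ∈ w ] ⟨ s ∘ₜ (t ∘ₜ u) ∣ r ⟩
      ≈⟨ ∑-cong x (λ s → ∑-∘q y v _) ⟨
    ∑[ s ∈ x ] ∑[ tu ∈ y ∘q v ] ∑[ r ∈ w ] ⟨ s ∘ₜ tu ∣ r ⟩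
      ≈⟨ ∑-∘q x (y ∘q v) _ ⟨
    ⟪ x ∘q (y ∘q v) , w ⟫ ∎

  ∘q-distribʳ : ∀ x y w → (x ⊕q y) ∘q w ≡ₘ (x ∘q w) ⊕q (y ∘q w)
  ∘q-distribʳ x y w = ≈⟪⟫⇒≡ₘ ((x ⊕q y) ∘q w) ((x ∘q w) ⊕q (y ∘q w)) λ v →
    reflexive (≡.cong ⟪_, v ⟫ (concatMap-++ _ x y))

  ∘q-distribˡ : ∀ x y w → w ∘q (x ⊕q y) ≡ₘ (w ∘q x) ⊕q (w ∘q y)
  ∘q-distribˡ x y w = ≈⟪⟫⇒≡ₘ (w ∘q (x ⊕q y)) ((w ∘q x) ⊕q (w ∘q y)) λ v → begin
    ⟪ w ∘q (x ⊕q y) , v ⟫                                    ≈⟨ ∑-∘q w (x ⊕q y) _ ⟩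
    ∑[ s ∈ w ] ∑[ t ∈ x ⊕q y ] ∑[ r ∈ v ] ⟨ s ∘ₜ t ∣ r ⟩        ≈⟨ ∑-cong w (λ s → ∑-++ x y _) ⟩
    ∑[ s ∈ w ] (∑[ t ∈ x ] ∑[ r ∈ v ] ⟨ s ∘ₜ t ∣ r ⟩ + ∑[ t ∈ y ] ∑[ r ∈ v ] ⟨ s ∘ₜ t ∣ r ⟩)
      ≈⟨ ∑-+ w _ _ ⟩
    ∑[ s ∈ w ] ∑[ t ∈ x ] ∑[ r ∈ v ] ⟨ s ∘ₜ t ∣ r ⟩ + ∑[ s ∈ w ] ∑[ t ∈ y ] ∑[ r ∈ v ] ⟨ s ∘ₜ t ∣ r ⟩
      ≈⟨ +-cong (∑-∘q w x _) (∑-∘q w y _) ⟨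
    ⟪ w ∘q x , v ⟫ + ⟪ w ∘q y , v ⟫                            ≈⟨ ⟪⊕q⟫ (w ∘q x) (w ∘q y) v ⟨
    ⟪ (w ∘q x) ⊕q (w ∘q y) , v ⟫                              ∎

  ⊙q-∘q : ∀ a x y → (a ⊙q x) ∘q y ≡ₘ a ⊙q (x ∘q y)
  ⊙q-∘q a x y = ≈⟪⟫⇒≡ₘ ((a ⊙q x) ∘q y) (a ⊙q (x ∘q y)) λ v → begin
    ⟪ (a ⊙q x) ∘q y , v ⟫                                     ≈⟨ ∑-∘q (a ⊙q x) y _ ⟩
    ∑[ s ∈ a ⊙q x ] ∑[ t ∈ y ] ∑[ r ∈ v ] ⟨ s ∘ₜ t ∣ r ⟩          ≈⟨ ∑-map _ x _ ⟩
    ∑[ s ∈ x ] ∑[ t ∈ y ] ∑[ r ∈ v ] ⟨ (a * proj₁ s) * proj₁ t , proj₂ s ∘ᴳ proj₂ t ∣ r ⟩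
      ≈⟨ ∑-cong x (λ s → ∑-cong y λ t → ∑-cong v λ r → ⟨∣⟩-coeff-cong _ r (*-assoc a (proj₁ s) (proj₁ t))) ⟩
    ∑[ s ∈ x ] ∑[ t ∈ y ] ∑[ r ∈ v ] ⟨ a * (proj₁ s * proj₁ t) , proj₂ s ∘ᴳ proj₂ t ∣ r ⟩
      ≈⟨ ∑-∘q x y _ ⟨
    ∑[ u ∈ x ∘q y ] ∑[ r ∈ v ] ⟨ a * proj₁ u , proj₂ u ∣ r ⟩       ≈⟨ ∑-map _ (x ∘q y) _ ⟨
    ⟪ a ⊙q (x ∘q y) , v ⟫                                     ∎

  ∘q-⊙q : ∀ a x y → x ∘q (a ⊙q y) ≡ₘ a ⊙q (x ∘q y)
  ∘q-⊙q a x y = ≈⟪⟫⇒≡ₘ (x ∘q (a ⊙q y)) (a ⊙q (x ∘q y)) λ v → begin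
    ⟪ x ∘q (a ⊙q y) , v ⟫                                     ≈⟨ ∑-∘q x (a ⊙q y) _ ⟩
    ∑[ s ∈ x ] ∑[ t ∈ a ⊙q y ] ∑[ r ∈ v ] ⟨ s ∘ₜ t ∣ r ⟩          ≈⟨ ∑-cong x (λ s → ∑-map _ y _) ⟩
    ∑[ s ∈ x ] ∑[ t ∈ y ] ∑[ r ∈ v ] ⟨ proj₁ s * (a * proj₁ t) , proj₂ s ∘ᴳ proj₂ t ∣ r ⟩
      ≈⟨ ∑-cong x (λ s → ∑-cong y λ t → ∑-cong v λ r → ⟨∣⟩-coeff-cong _ r (x∙yz≈y∙xz (proj₁ s) a (proj₁ t))) ⟩
    ∑[ s ∈ x ] ∑[ t ∈ y ] ∑[ r ∈ v ] ⟨ a * (proj₁ s * proj₁ t) , proj₂ s ∘ᴳ proj₂ t ∣ r ⟩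
      ≈⟨ ∑-∘q x y _ ⟨
    ∑[ u ∈ x ∘q y ] ∑[ r ∈ v ] ⟨ a * proj₁ u , proj₂ u ∣ r ⟩       ≈⟨ ∑-map _ (x ∘q y) _ ⟨
    ⟪ a ⊙q (x ∘q y) , v ⟫                                     ∎

  concat₀ : QG R 2 → QG R 2 → QG0 R
  concat₀ x y =
    concatMap (λ s → map (λ t → proj₁ s * proj₁ t , proj₂ s ∘ᴳ proj₂ t , ∘ᴳ-nonadj (proj₂ s) (proj₂ t)) y) x

  embed0-concat₀ : ∀ x y → embed0 R (concat₀ x y) ≡ x ∘q y
  embed0-concat₀ x y = ≡.trans (map-concatMap _ _ x) (concatMap-cong (λ s → ≡.sym (map-∘ y)) x)

  contracted : Term → Term → K
  contracted s t =
    (proj₁ s * proj₁ t) * φ (forget (contract (proj₂ s ∘ᴳ proj₂ t) (∘ᴳ-nonadj (proj₂ s) (proj₂ t))))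

  evalQ-contract-concat₀ : ∀ x y →
                           evalQ R f (contractQ R (concat₀ x y)) ≈ ∑[ s ∈ x ] ∑[ t ∈ y ] contracted s t
  evalQ-contract-concat₀ x y =
    trans (evalQ-∑ (contractQ R (concat₀ x y))) (trans (∑-map _ (concat₀ x y) _) (∑-pairs _ x y _))

  contracted-∘ₜ-reverseₜ : ∀ r t → contracted r (reverseₜ t) ≈ ⟨ t ∣ r ⟩
  contracted-∘ₜ-reverseₜ (a , W) (b , F) = *-cong (*-comm a b) (φ-iso (contract-∘ᴳ-reverseᴳ W F))

  contracted-reverseₜ-∘ₜ : ∀ t r → contracted (reverseₜ t) r ≈ ⟨ t ∣ r ⟩
  contracted-reverseₜ-∘ₜ (a , F) (b , W) = *-congˡ (φ-iso (contract-reverseᴳ-∘ᴳ F W))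

  module _ {z : QG R 2} (z-contractor : IsContractor R f z) where

    ⟪∘q⟫-contractor : ∀ x y → ⟪ x ∘q y , z ⟫ ≈ ∑[ s ∈ x ] ∑[ t ∈ y ] contracted s t
    ⟪∘q⟫-contractor x y = begin
      ⟪ x ∘q y , z ⟫                          ≈⟨ evalQ-·q (x ∘q y) z ⟨
      evalQ R f ((x ∘q y) ·q z)               ≡⟨ ≡.cong (λ u → evalQ R f (u ·q z)) (embed0-concat₀ x y) ⟨
      evalQ R f (embed0 R (concat₀ x y) ·q z) ≈⟨ z-contractor (concat₀ x y) ⟩
      evalQ R f (contractQ R (concat₀ x y))   ≈⟨ evalQ-contract-concat₀ x y ⟩
      ∑[ s ∈ x ] ∑[ t ∈ y ] contracted s t    ∎

    contractor-identityˡ : ∀ x → z ∘q x ≡ₘ x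
    contractor-identityˡ x = ≈⟪⟫⇒≡ₘ (z ∘q x) x λ w → begin
      ⟪ z ∘q x , w ⟫                                   ≈⟨ ⟪∘q⟫-moveʳ z x w ⟩
      ⟪ z , w ∘q reverseQ x ⟫                          ≈⟨ ⟪⟫-comm z (w ∘q reverseQ x) ⟩
      ⟪ w ∘q reverseQ x , z ⟫                          ≈⟨ ⟪∘q⟫-contractor w (reverseQ x) ⟩
      ∑[ r ∈ w ] ∑[ t ∈ reverseQ x ] contracted r t    ≈⟨ ∑-cong w (λ r → ∑-reverseQ x _) ⟩
      ∑[ r ∈ w ] ∑[ t ∈ x ] contracted r (reverseₜ t)
        ≈⟨ ∑-cong w (λ r → ∑-cong x λ t → contracted-∘ₜ-reverseₜ r t) ⟩
      ∑[ r ∈ w ] ∑[ t ∈ x ] ⟨ t ∣ r ⟩                  ≈⟨ ∑-comm w x _ ⟩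
      ⟪ x , w ⟫                                        ∎

    contractor-identityʳ : ∀ x → x ∘q z ≡ₘ x
    contractor-identityʳ x = ≈⟪⟫⇒≡ₘ (x ∘q z) x λ w → begin
      ⟪ x ∘q z , w ⟫                                   ≈⟨ ⟪∘q⟫-moveˡ x z w ⟩
      ⟪ z , reverseQ x ∘q w ⟫                          ≈⟨ ⟪⟫-comm z (reverseQ x ∘q w) ⟩
      ⟪ reverseQ x ∘q w , z ⟫                          ≈⟨ ⟪∘q⟫-contractor (reverseQ x) w ⟩
      ∑[ t ∈ reverseQ x ] ∑[ r ∈ w ] contracted t r    ≈⟨ ∑-reverseQ x _ ⟩
      ∑[ t ∈ x ] ∑[ r ∈ w ] contracted (reverseₜ t) r
        ≈⟨ ∑-cong x (λ t → ∑-cong w λ r → contracted-reverseₜ-∘ₜ t r) ⟩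
      ⟪ x , w ⟫                                        ∎

lemma1p3 : ∀ {c ℓ} (R : CommutativeRing c ℓ) (f : GraphParameter R) (z : QG R 2) →
    IsContractor R f z →
    -- concatenation is well defined on G₂/f
    (∀ x x′ y y′ → EqMod R f x x′ → EqMod R f y y′ →
      EqMod R f (_∘Q_ R x y) (_∘Q_ R x′ y′)) ×
    -- associative
    (∀ x y w → EqMod R f (_∘Q_ R (_∘Q_ R x y) w) (_∘Q_ R x (_∘Q_ R y w))) ×
    -- bilinear
    (∀ x y w → EqMod R f (_∘Q_ R (_⊕_ R x y) w) (_⊕_ R (_∘Q_ R x w) (_∘Q_ R y w))) ×
    (∀ x y w → EqMod R f (_∘Q_ R w (_⊕_ R x y)) (_⊕_ R (_∘Q_ R w x) (_∘Q_ R w y))) ×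
    (∀ a x y → EqMod R f (_∘Q_ R (_⊙_ R a x) y) (_⊙_ R a (_∘Q_ R x y))) ×
    (∀ a x y → EqMod R f (_∘Q_ R x (_⊙_ R a y)) (_⊙_ R a (_∘Q_ R x y))) ×
    -- the class of z is a two-sided unit for ∘
    (∀ x → EqMod R f (_∘Q_ R z x) x) ×
    (∀ x → EqMod R f (_∘Q_ R x z) x)
lemma1p3 R f z z-contractor =
  ∘q-cong , ∘q-assoc , ∘q-distribʳ , ∘q-distribˡ , ⊙q-∘q , ∘q-⊙q ,
  contractor-identityˡ z-contractor , contractor-identityʳ z-contractor
  where open QuantumAlgebra R f
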